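{- Every quantum logic is a paraconsistent logic. Conversely, there exists a paraconsistent logic which is not a quantum logic.
   Context: Let $L$ be a lattice with universal bounds $0$ and $1$ (i.e. $0 \leqq x \leqq 1$ for all $x\in L$). A mapping $': L \to L$, $x\mapsto x'$, is called a fuzzy negation if for all $x,y\in L$: (weak double negation) $x \leqq (x')'$; (antitony) $x \leqq y$ implies $y' \leqq x'$; (Boolean boundary condition) $0' = 1$ and $1' = 0$. The pair $(L,{}')$ is then called a fuzzy logic. A fuzzy logic is called a logic if $x \wedge x' = 0$ for all $x\in L$. A paraconsistent logic is a fuzzy logic satisfying: for all $x,y\in L$, if $x \leqq y$ and $x' \wedge y = 0$ then $x = y$. A quantum logic is a logic satisfying the orthomodular identity: for all $x,y\in L$, if $x \leqq y$ then $x \vee (x' \wedge y) = y$. -}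

module Defs where

open import Level using (Level; _⊔_)
open import Data.Product using (_×_)
open import Relation.Binary.Lattice.Bundles using (BoundedLattice)

module _ {c ℓ₁ ℓ₂ : Level} (L : BoundedLattice c ℓ₁ ℓ₂) where
  open BoundedLattice L

  record IsFuzzyNegation (neg : Carrier → Carrier) : Set (c ⊔ ℓ₁ ⊔ ℓ₂) where
    field
      weakDoubleNeg : ∀ x → x ≤ neg (neg x)
      antitone      : ∀ x y → x ≤ y → neg y ≤ neg x
      neg-⊥         : neg ⊥ ≈ ⊤
      neg-⊤         : neg ⊤ ≈ ⊥

  record IsLogic (neg : Carrier → Carrier) : Set (c ⊔ ℓ₁ ⊔ ℓ₂) where
    field
      isFuzzyNegation : IsFuzzyNegation neg
      noncontradiction : ∀ x → (x ∧ neg x) ≈ ⊥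

  record IsParaconsistentLogic (neg : Carrier → Carrier) : Set (c ⊔ ℓ₁ ⊔ ℓ₂) where
    field
      isFuzzyNegation : IsFuzzyNegation neg
      paraconsistency : ∀ x y → x ≤ y → (neg x ∧ y) ≈ ⊥ → x ≈ y

  record IsQuantumLogic (neg : Carrier → Carrier) : Set (c ⊔ ℓ₁ ⊔ ℓ₂) where
    field
      isLogic      : IsLogic neg
      orthomodular : ∀ x y → x ≤ y → (x ∨ (neg x ∧ y)) ≈ y

-- Orthomodularity makes x′ ∧ y the relative complement of x in [x, y], so x′ ∧ y = 0
-- forces y = x ∨ (x′ ∧ y) = x ∨ 0 = x.  For the converse, reversal i ↦ n − i on the chain
-- 0 < 1 < ⋯ < n is a paraconsistent negation: if x′ ∧ y = 0 in a chain then y = 0 or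
-- x′ = 0, i.e. x = n, and either way x ≤ y pins x = y.  For n ≥ 2 it is not a logic,
-- since 1 ∧ 1′ = 1.
module Submission where

open import Defs
open import Level using (Level; 0ℓ)
open import Data.Product using (_×_; Σ-syntax; _,_)
open import Data.Sum using (inj₁; inj₂)
open import Data.Nat as ℕ using (ℕ; suc; _∸_)
import Data.Nat.Properties as ℕ
open import Data.Fin as Fin using (Fin; zero; suc; toℕ; fromℕ; opposite)
import Data.Fin.Properties as Fin
open import Function using (_∘_)
open import Relation.Nullary using (¬_)
open import Relation.Binary.Bundles using (TotalOrder)
open import Relation.Binary.Definitions using (Maximum; Minimum)
open import Relation.Binary.Lattice.Bundles using (BoundedLattice)
open import Relation.Binary.PropositionalEquality using (_≡_; refl; sym; trans; cong; subst)
import Relation.Binary.Lattice.Properties.BoundedJoinSemilattice as BoundedJoinSemilatticeProperties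
import Relation.Binary.Lattice.Properties.JoinSemilattice as JoinSemilatticeProperties
import Relation.Binary.Reasoning.Setoid as SetoidReasoning
import Algebra.Construct.NaturalChoice.Min as Min
import Algebra.Construct.NaturalChoice.Max as Max

module _ {c ℓ₁ ℓ₂ : Level} (L : BoundedLattice c ℓ₁ ℓ₂) where
  open BoundedLattice L
  open BoundedJoinSemilatticeProperties boundedJoinSemilattice using (identityʳ)
  open JoinSemilatticeProperties joinSemilattice using (∨-cong)
  open SetoidReasoning setoid

  orthomodular⇒paraconsistent : {neg : Carrier → Carrier} →
                                (∀ x y → x ≤ y → (x ∨ (neg x ∧ y)) ≈ y) →
                                ∀ x y → x ≤ y → (neg x ∧ y) ≈ ⊥ → x ≈ y
  orthomodular⇒paraconsistent {neg} orthomodular x y x≤y x′∧y≈⊥ = begin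
    x                ≈⟨ identityʳ x ⟨
    x ∨ ⊥            ≈⟨ ∨-cong Eq.refl x′∧y≈⊥ ⟨
    x ∨ (neg x ∧ y)  ≈⟨ orthomodular x y x≤y ⟩
    y                ∎

  quantumLogic⇒paraconsistentLogic : {neg : Carrier → Carrier} →
                                     IsQuantumLogic L neg → IsParaconsistentLogic L neg
  quantumLogic⇒paraconsistentLogic q = record
    { isFuzzyNegation = IsLogic.isFuzzyNegation (IsQuantumLogic.isLogic q)
    ; paraconsistency = orthomodular⇒paraconsistent (IsQuantumLogic.orthomodular q)
    }

module _ {a ℓ₁ ℓ₂ : Level} (O : TotalOrder a ℓ₁ ℓ₂) where
  open TotalOrder O using (Carrier; _≈_; _≤_; isPartialOrder)
  open Min O using (_⊓_; x⊓y≤x; x⊓y≤y; ⊓-glb)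
  open Max O using (_⊔_; x≤x⊔y; x≤y⊔x; ⊔-lub)

  totalOrder⇒boundedLattice : {top bot : Carrier} →
                              Maximum _≤_ top → Minimum _≤_ bot → BoundedLattice a ℓ₁ ℓ₂
  totalOrder⇒boundedLattice {top} {bot} maximum minimum = record
    { Carrier = Carrier
    ; _≈_ = _≈_
    ; _≤_ = _≤_
    ; _∨_ = _⊔_
    ; _∧_ = _⊓_
    ; ⊤ = top
    ; ⊥ = bot
    ; isBoundedLattice = record
      { isLattice = record
        { isPartialOrder = isPartialOrder
        ; supremum = λ x y → x≤x⊔y x y , x≤y⊔x x y , λ _ → ⊔-lub
        ; infimum = λ x y → x⊓y≤x x y , x⊓y≤y x y , λ _ → ⊓-glb
        }
      ; maximum = maximum
      ; minimum = minimum
      }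
    }

chain : ℕ → BoundedLattice 0ℓ 0ℓ 0ℓ
chain n = totalOrder⇒boundedLattice (Fin.≤-totalOrder (suc n)) Fin.≤fromℕ (λ _ → ℕ.z≤n)

opposite-antimono-≤ : ∀ {n} {i j : Fin n} → i Fin.≤ j → opposite j Fin.≤ opposite i
opposite-antimono-≤ {n} {i} {j} i≤j = begin
  toℕ (opposite j)  ≡⟨ Fin.opposite-prop j ⟩
  n ∸ suc (toℕ j)   ≤⟨ ℕ.∸-monoʳ-≤ n (ℕ.s≤s i≤j) ⟩
  n ∸ suc (toℕ i)   ≡⟨ Fin.opposite-prop i ⟨
  toℕ (opposite i)  ∎
  where open ℕ.≤-Reasoning

module _ (n : ℕ) where
  open BoundedLattice (chain n) using (_≤_; _∧_; reflexive; antisym)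
  open Min (Fin.≤-totalOrder (suc n)) using (⊓-sel)

  opposite-isFuzzyNegation : IsFuzzyNegation (chain n) opposite
  opposite-isFuzzyNegation = record
    { weakDoubleNeg = λ x → reflexive (sym (Fin.opposite-involutive x))
    ; antitone      = λ _ _ → opposite-antimono-≤
    ; neg-⊥         = refl
    ; neg-⊤         = Fin.opposite-involutive zero
    }

  opposite-paraconsistency : ∀ i j → i ≤ j → (opposite i ∧ j) ≡ zero → i ≡ j
  opposite-paraconsistency i j i≤j i′∧j≡0 with ⊓-sel (opposite i) j
  ... | inj₁ i′∧j≡i′ = antisym i≤j (subst (j ≤_) (sym i≡top) (Fin.≤fromℕ j))
    where
    i≡top : i ≡ fromℕ n
    i≡top = trans (sym (Fin.opposite-involutive i))
                  (cong opposite (trans (sym i′∧j≡i′) i′∧j≡0))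
  ... | inj₂ i′∧j≡j = antisym i≤j (subst (_≤ i) (sym j≡bot) ℕ.z≤n)
    where
    j≡bot : j ≡ zero
    j≡bot = trans (sym i′∧j≡j) i′∧j≡0

  opposite-isParaconsistentLogic : IsParaconsistentLogic (chain n) opposite
  opposite-isParaconsistentLogic = record
    { isFuzzyNegation = opposite-isFuzzyNegation
    ; paraconsistency = opposite-paraconsistency
    }

opposite-¬isLogic : ∀ n → ¬ IsLogic (chain (suc (suc n))) opposite
opposite-¬isLogic n isLogic with subst (one ≤_) (IsLogic.noncontradiction isLogic one)
                                       (⊓-glb ℕ.≤-refl one≤one′)
  where
  open BoundedLattice (chain (suc (suc n))) using (_≤_)
  open Min (Fin.≤-totalOrder (suc (suc (suc n)))) using (⊓-glb)
  one : Fin (suc (suc (suc n)))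
  one = suc zero
  one≤one′ : one ≤ opposite one
  one≤one′ = subst (1 ℕ.≤_) (sym (Fin.opposite-prop one)) (ℕ.s≤s ℕ.z≤n)
... | ()

mainTheorem5 : (c ℓ₁ ℓ₂ : Level) → ((∀ (L : BoundedLattice c ℓ₁ ℓ₂) (neg : BoundedLattice.Carrier L → BoundedLattice.Carrier L) → IsQuantumLogic L neg → IsParaconsistentLogic L neg)
    × (Σ[ L ∈ BoundedLattice 0ℓ 0ℓ 0ℓ ] Σ[ neg ∈ (BoundedLattice.Carrier L → BoundedLattice.Carrier L) ] (IsParaconsistentLogic L neg × ¬ IsQuantumLogic L neg)))
mainTheorem5 _ _ _ =
    (λ L _ → quantumLogic⇒paraconsistentLogic L)
  , chain 2 , opposite
  , opposite-isParaconsistentLogic 2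
  , opposite-¬isLogic 0 ∘ IsQuantumLogic.isLogic
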